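{- There is an absolute constant $C$ such that every ordered rooted tree $T$ with $n\ge 1$ nodes has at most $Cn^2$ distinct subforests.
   Context: An ordered rooted tree is a rooted tree in which the children of every node are linearly ordered; a forest is a linearly ordered sequence of disjoint ordered rooted trees. Removing a node $v$ from a forest means deleting $v$ and putting its children, in their order, in the place of $v$ in the child list of its parent (or in the sequence of trees, if $v$ is a root). The leftmost (resp. rightmost) root of a nonempty forest is the root of its first (resp. last) tree. A subforest of a rooted tree $T$ is any forest obtained from $T$ by a finite (possibly empty) sequence of operations, each of which removes the leftmost root or the rightmost root of the current forest (so $T$ itself and the empty forest are subforests). -}

module Defs where

open import Data.Nat using (ℕ; suc; _+_)
open import Data.List using (List; []; _∷_; _++_; _∷ʳ_)
open import Relation.Binary.Construct.Closure.ReflexiveTransitive using (Star)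

-- Ordered rooted trees whose nodes carry labels from ℕ
-- (labels may be used to give nodes distinct identities).
data Tree : Set where
  node : ℕ → List Tree → Tree

Forest : Set
Forest = List Tree

mutual
  size : Tree → ℕ
  size (node _ cs) = suc (sizeF cs)

  sizeF : Forest → ℕ
  sizeF []       = 0
  sizeF (t ∷ ts) = size t + sizeF ts

data Step : Forest → Forest → Set where
  removeLeft  : ∀ a cs fs → Step (node a cs ∷ fs) (cs ++ fs)
  removeRight : ∀ a cs fs → Step (fs ∷ʳ node a cs) (fs ++ cs)

Subforest : Tree → Forest → Set
Subforest T F = Star Step (T ∷ []) F

{-# OPTIONS --safe #-}
-- Removing the leftmost root and removing the rightmost root commute on forests
-- with at least two trees, and coincide on a single tree.  Hence every subforest
-- of T has the form R^r (L^l [T]) for the two removal maps L and R, and since each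
-- removal destroys a node we may take l, r ≤ n.  So there are at most (n+1)² ≤ 4n²
-- subforests.
module Submission where

open import Defs
open import Data.Nat using (ℕ; zero; suc; _+_; _*_; _≤_; _⊓_; z≤n; s≤s)
open import Data.Nat.Properties
  using (≤-refl; ≤-trans; ≤-reflexive; n≤1+n; +-assoc; +-suc; +-identityʳ;
         m⊓n≤n; *-mono-≤; +-monoˡ-≤; module ≤-Reasoning)
open import Data.Nat.Tactic.RingSolver using (solve-∀)
open import Data.List using (List; []; _∷_; _++_; _∷ʳ_; length; map; upTo; cartesianProductWith)
open import Data.List.Properties using (length-++; length-map; length-upTo; ++-identityʳ; length-removeAt′)
open import Data.List.Relation.Unary.All as All using (All; []; _∷_)
open import Data.List.Relation.Unary.AllPairs using ([]; _∷_)
open import Data.List.Relation.Unary.Any using (here; there; index; _─_)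
open import Data.List.Relation.Unary.Unique.Propositional using (Unique)
open import Data.List.Membership.Propositional using (_∈_)
open import Data.List.Membership.Propositional.Properties using (∈-upTo⁺; ∈-cartesianProductWith⁺)
open import Data.Product using (∃; ∃₂; _,_)
open import Data.Sum using (_⊎_; inj₁; inj₂)
open import Relation.Nullary using (contradiction)
open import Relation.Binary.PropositionalEquality
open import Relation.Binary.Construct.Closure.ReflexiveTransitive using (Star; ε; _◅_)

module _ {a} {A : Set a} where

  ∈-─⁺ : ∀ {x y} {xs : List A} (x∈xs : x ∈ xs) → y ∈ xs → x ≢ y → y ∈ (xs ─ x∈xs)
  ∈-─⁺ (here refl)  (here refl)  x≢y = contradiction refl x≢y
  ∈-─⁺ (here _)     (there y∈xs) _   = y∈xs
  ∈-─⁺ (there _)    (here y≡x)   _   = here y≡x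
  ∈-─⁺ (there x∈xs) (there y∈xs) x≢y = there (∈-─⁺ x∈xs y∈xs x≢y)

  unique-⊆⇒length≤ : ∀ {xs ys : List A} → Unique xs → All (_∈ ys) xs → length xs ≤ length ys
  unique-⊆⇒length≤ [] [] = z≤n
  unique-⊆⇒length≤ {x ∷ xs} {ys} (x≢xs ∷ unique) (x∈ys ∷ xs⊆ys) = begin
    suc (length xs)           ≤⟨ s≤s (unique-⊆⇒length≤ unique xs⊆ys−x) ⟩
    suc (length (ys ─ x∈ys))  ≡⟨ sym (length-removeAt′ ys (index x∈ys)) ⟩
    length ys                 ∎
    where
    open ≤-Reasoning
    xs⊆ys−x : All (_∈ (ys ─ x∈ys)) xs
    xs⊆ys−x = All.zipWith (λ (x≢y , y∈ys) → ∈-─⁺ x∈ys y∈ys x≢y) (x≢xs , xs⊆ys)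

  length-cartesianProductWith : ∀ {b c} {B : Set b} {C : Set c} (f : A → B → C) xs ys →
    length (cartesianProductWith f xs ys) ≡ length xs * length ys
  length-cartesianProductWith f []       ys = refl
  length-cartesianProductWith f (x ∷ xs) ys = begin
    length (map (f x) ys ++ cartesianProductWith f xs ys)  ≡⟨ length-++ (map (f x) ys) ⟩
    length (map (f x) ys) + length (cartesianProductWith f xs ys)
      ≡⟨ cong₂ _+_ (length-map (f x) ys) (length-cartesianProductWith f xs ys) ⟩
    length ys + length xs * length ys                      ∎
    where open ≡-Reasoning

  iterate : (A → A) → ℕ → A → A
  iterate f zero    x = x
  iterate f (suc k) x = iterate f k (f x)

  iterate-+ : ∀ f m n x → iterate f (m + n) x ≡ iterate f n (iterate f m x)
  iterate-+ f zero    n x = refl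
  iterate-+ f (suc m) n x = iterate-+ f m n (f x)

  iterate-fixedPoint : ∀ f {x} → f x ≡ x → ∀ k → iterate f k x ≡ x
  iterate-fixedPoint f fx≡x zero    = refl
  iterate-fixedPoint f fx≡x (suc k) rewrite fx≡x = iterate-fixedPoint f fx≡x k

dropLeftRoot : Forest → Forest
dropLeftRoot []               = []
dropLeftRoot (node _ cs ∷ fs) = cs ++ fs

children : Tree → Forest
children (node _ cs) = cs

dropRightRoot : Forest → Forest
dropRightRoot []           = []
dropRightRoot (t ∷ [])     = children t
dropRightRoot (t ∷ u ∷ fs) = t ∷ dropRightRoot (u ∷ fs)

dropLeftRoots dropRightRoots : ℕ → Forest → Forest
dropLeftRoots  = iterate dropLeftRoot
dropRightRoots = iterate dropRightRoot

trim : ℕ → ℕ → Forest → Forest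
trim l r X = dropRightRoots r (dropLeftRoots l X)

dropRightRoot-++ : ∀ xs y ys → dropRightRoot (xs ++ y ∷ ys) ≡ xs ++ dropRightRoot (y ∷ ys)
dropRightRoot-++ []            y ys = refl
dropRightRoot-++ (x ∷ [])      y ys = refl
dropRightRoot-++ (x ∷ x′ ∷ xs) y ys = cong (x ∷_) (dropRightRoot-++ (x′ ∷ xs) y ys)

dropRightRoot-∷ʳ : ∀ fs a cs → dropRightRoot (fs ∷ʳ node a cs) ≡ fs ++ cs
dropRightRoot-∷ʳ fs a cs = dropRightRoot-++ fs (node a cs) []

step⇒dropRoot : ∀ {X Y} → Step X Y → Y ≡ dropLeftRoot X ⊎ Y ≡ dropRightRoot X
step⇒dropRoot (removeLeft a cs fs)  = inj₁ refl
step⇒dropRoot (removeRight a cs fs) = inj₂ (sym (dropRightRoot-∷ʳ fs a cs))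

dropLeftRoot-dropRightRoot-comm : ∀ t u fs →
  dropLeftRoot (dropRightRoot (t ∷ u ∷ fs)) ≡ dropRightRoot (dropLeftRoot (t ∷ u ∷ fs))
dropLeftRoot-dropRightRoot-comm (node _ cs) u fs = sym (dropRightRoot-++ cs u fs)

dropLeftRoots-dropRightRoot : ∀ k X → ∃₂ λ (l r : ℕ) → dropLeftRoots k (dropRightRoot X) ≡ trim l r X
dropLeftRoots-dropRightRoot k [] = 0 , 0 , iterate-fixedPoint dropLeftRoot refl k
dropLeftRoots-dropRightRoot k (node _ cs ∷ []) = suc k , 0 , cong (dropLeftRoots k) (sym (++-identityʳ cs))
dropLeftRoots-dropRightRoot zero    (t ∷ u ∷ fs) = 0 , 1 , refl
dropLeftRoots-dropRightRoot (suc k) (t ∷ u ∷ fs)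
  with l , r , eq ← dropLeftRoots-dropRightRoot k (dropLeftRoot (t ∷ u ∷ fs)) =
  suc l , r , trans (cong (dropLeftRoots k) (dropLeftRoot-dropRightRoot-comm t u fs)) eq

trim-dropRightRoot : ∀ l r X → ∃₂ λ (l′ r′ : ℕ) → trim l r (dropRightRoot X) ≡ trim l′ r′ X
trim-dropRightRoot l r X with l′ , r′ , eq ← dropLeftRoots-dropRightRoot l X =
  l′ , r′ + r , trans (cong (dropRightRoots r) eq) (sym (iterate-+ dropRightRoot r′ r _))

reachable⇒trim : ∀ {X F} → Star Step X F → ∃₂ λ (l r : ℕ) → F ≡ trim l r X
reachable⇒trim ε = 0 , 0 , refl
reachable⇒trim (step ◅ steps) with reachable⇒trim steps | step⇒dropRoot step
... | l , r , refl | inj₁ refl = suc l , r , refl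
... | l , r , refl | inj₂ refl = trim-dropRightRoot l r _

sizeF-++ : ∀ xs ys → sizeF (xs ++ ys) ≡ sizeF xs + sizeF ys
sizeF-++ []       ys = refl
sizeF-++ (x ∷ xs) ys = trans (cong (size x +_) (sizeF-++ xs ys)) (sym (+-assoc (size x) _ _))

sizeF-dropLeftRoot : ∀ t ts → suc (sizeF (dropLeftRoot (t ∷ ts))) ≡ sizeF (t ∷ ts)
sizeF-dropLeftRoot (node _ cs) ts = cong suc (sizeF-++ cs ts)

sizeF-dropRightRoot : ∀ t ts → suc (sizeF (dropRightRoot (t ∷ ts))) ≡ sizeF (t ∷ ts)
sizeF-dropRightRoot (node _ cs) [] = cong suc (sym (+-identityʳ (sizeF cs)))
sizeF-dropRightRoot t (u ∷ ts) = trans (sym (+-suc (size t) _)) (cong (size t +_) (sizeF-dropRightRoot u ts))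

module RootRemoval (f : Forest → Forest) (f-[] : f [] ≡ [])
                   (sizeF-f : ∀ t ts → suc (sizeF (f (t ∷ ts))) ≡ sizeF (t ∷ ts)) where

  sizeF-iterate≤ : ∀ k X → sizeF (iterate f k X) ≤ sizeF X
  sizeF-iterate≤ zero    X        = ≤-refl
  sizeF-iterate≤ (suc k) []       rewrite f-[] = sizeF-iterate≤ k []
  sizeF-iterate≤ (suc k) (t ∷ ts) =
    ≤-trans (sizeF-iterate≤ k (f (t ∷ ts))) (≤-trans (n≤1+n _) (≤-reflexive (sizeF-f t ts)))

  -- Each removal destroys a node, so after sizeF X of them the forest is empty.
  iterate-⊓-sizeF : ∀ k X → iterate f k X ≡ iterate f (k ⊓ sizeF X) X
  iterate-⊓-sizeF zero    X = refl
  iterate-⊓-sizeF (suc k) [] rewrite f-[] = iterate-fixedPoint f f-[] k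
  iterate-⊓-sizeF (suc k) (t ∷ ts) rewrite sym (sizeF-f t ts) = iterate-⊓-sizeF k (f (t ∷ ts))

module Left  = RootRemoval dropLeftRoot  refl sizeF-dropLeftRoot
module Right = RootRemoval dropRightRoot refl sizeF-dropRightRoot

trims : ℕ → Forest → List Forest
trims n X = cartesianProductWith (λ l r → trim l r X) (upTo (suc n)) (upTo (suc n))

length-trims : ∀ n X → length (trims n X) ≡ suc n * suc n
length-trims n X = trans (length-cartesianProductWith (λ l r → trim l r X) (upTo (suc n)) (upTo (suc n)))
                         (cong₂ _*_ (length-upTo (suc n)) (length-upTo (suc n)))

reachable⇒∈trims : ∀ {n X F} → sizeF X ≤ n → Star Step X F → F ∈ trims n X
reachable⇒∈trims {n} {X} sizeF≤n steps with l , r , refl ← reachable⇒trim steps =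
  subst (_∈ trims n X) (sym trim-eq)
        (∈-cartesianProductWith⁺ (λ l r → trim l r X) (∈-upTo⁺ (s≤s l′≤n)) (∈-upTo⁺ (s≤s r′≤n)))
  where
  l′ = l ⊓ sizeF X
  Y  = dropLeftRoots l′ X
  r′ = r ⊓ sizeF Y
  l′≤n : l′ ≤ n
  l′≤n = ≤-trans (m⊓n≤n l (sizeF X)) sizeF≤n
  r′≤n : r′ ≤ n
  r′≤n = ≤-trans (m⊓n≤n r (sizeF Y)) (≤-trans (Left.sizeF-iterate≤ l′ X) sizeF≤n)
  trim-eq : trim l r X ≡ trim l′ r′ X
  trim-eq = trans (cong (dropRightRoots r) (Left.iterate-⊓-sizeF l X)) (Right.iterate-⊓-sizeF r Y)

suc-square≤4*square : ∀ {n} → 1 ≤ n → suc n * suc n ≤ 4 * (n * n)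
suc-square≤4*square {n} 1≤n = ≤-trans (*-mono-≤ suc-n≤2n suc-n≤2n) (≤-reflexive (double-square n))
  where
  suc-n≤2n : suc n ≤ n + n
  suc-n≤2n = +-monoˡ-≤ n 1≤n
  double-square : ∀ m → (m + m) * (m + m) ≡ 4 * (m * m)
  double-square = solve-∀

proposition5 : ∃ λ (C : ℕ) → (T : Tree) → 1 ≤ size T →
                   (L : List Forest) → Unique L → All (Subforest T) L →
                   length L ≤ C * (size T * size T)
proposition5 = 4 , λ T 1≤n L unique subforests →
  let open ≤-Reasoning
      n = size T
  in begin
    length L                  ≤⟨ unique-⊆⇒length≤ unique
                                   (All.map (reachable⇒∈trims (≤-reflexive (+-identityʳ n))) subforests) ⟩
    length (trims n (T ∷ [])) ≡⟨ length-trims n (T ∷ []) ⟩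
    suc n * suc n             ≤⟨ suc-square≤4*square 1≤n ⟩
    4 * (n * n)               ∎
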